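{- If $\Lambda\in\widetilde{\mathrm{NC}}^D(n)$, then $|\Lambda^+|=2n+2-|\Lambda|$ if $-1$ is the greatest element of its block in $\Lambda$, and $|\Lambda^+|=2n-|\Lambda|$ otherwise.
   Context: For a set partition $\Lambda$ of a finite set $X\subset\mathbb{Z}$, $(i,j)$ with $i<j$ is an arc if $i,j$ share a block and $j$ is the least element of that block greater than $i$; $\mathrm{Arc}(\Lambda)$ is the set of arcs (it determines $\Lambda$); $|\Lambda|$ is the number of blocks. $\Lambda^+$ is the partition of $X$ with arc set $(\mathrm{Arc}(\Lambda)\setminus\mathcal{S})\cup\mathcal{T}$, where $\mathcal{S}=\{(i,i+1):i\in\mathbb{Z}\}$ and $\mathcal{T}$ is the set of pairs $(i,i+1)\in X\times X$ (consecutive integers both in $X$) with $i$ maximal in its block and $i+1$ minimal in its block. Let $[\pm n]=\{\pm1,\dots,\pm n\}$, $-\Lambda=\{ -B:B\in\Lambda\}$. $\Pi^D(n)$ is the set of partitions $\Lambda$ of $[\pm n]$ with $-\Lambda=\Lambda$ and no block $B$ with $B=-B$. $\widetilde{\mathrm{NC}}^D(n)$ is the set of $\Lambda\in\Pi^D(n)$ such that whenever $(i,k),(j,l)\in\mathrm{Arc}(\Lambda)$ with $i<j<k<l$ one has $(i,k)=(-l,-j)$. -}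

module Defs where

open import Data.Nat as ℕ using (ℕ; suc)
open import Data.Integer as ℤ using (ℤ; +_; -[1+_]; -_; _<_; _≤_; _+_; 1ℤ)
open import Data.List using (List; map; _++_; upTo; length; deduplicate)
open import Data.List.Membership.Propositional using (_∈_)
open import Data.Product using (_×_; Σ)
open import Data.Sum using (_⊎_)
open import Relation.Binary.PropositionalEquality using (_≡_; _≢_)
open import Relation.Nullary using (¬_)
open import Function.Bundles using (_⇔_)

-- [±n] = {-n,…,-1,1,…,n} as a list of integers
pm : ℕ → List ℤ
pm n = map (λ k → -[1+ k ]) (upTo n) ++ map (λ k → + suc k) (upTo n)

-- A set partition of [±n] is given as the kernel of a labelling
-- (i and j lie in the same block iff they have the same label);
-- only the values on [±n] matter.
Labelling : Set
Labelling = ℤ → ℕ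

Same : Labelling → ℤ → ℤ → Set
Same Λ i j = Λ i ≡ Λ j

-- number of blocks |Λ| of the partition of [±n] = number of distinct labels on [±n]
blocks : ℕ → Labelling → ℕ
blocks n Λ = length (deduplicate ℕ._≟_ (map Λ (pm n)))

Arc : ℕ → Labelling → ℤ → ℤ → Set
Arc n Λ i j =
  i ∈ pm n × j ∈ pm n × i < j × Same Λ i j ×
  (∀ k → k ∈ pm n → i < k → k < j → ¬ Same Λ i k)

MaxInBlock : ℕ → Labelling → ℤ → Set
MaxInBlock n Λ i = ∀ j → j ∈ pm n → Same Λ i j → j ≤ i

MinInBlock : ℕ → Labelling → ℤ → Set
MinInBlock n Λ i = ∀ j → j ∈ pm n → Same Λ i j → i ≤ j

-- arc set of Λ⁺ : (Arc(Λ) ∖ S) ∪ T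
ArcPlus : ℕ → Labelling → ℤ → ℤ → Set
ArcPlus n Λ i j =
  (Arc n Λ i j × j ≢ i + 1ℤ)
  ⊎ (j ≡ i + 1ℤ × i ∈ pm n × j ∈ pm n × MaxInBlock n Λ i × MinInBlock n Λ j)

InΠD : ℕ → Labelling → Set
InΠD n Λ =
  (∀ i j → i ∈ pm n → j ∈ pm n → Same Λ i j ⇔ Same Λ (- i) (- j))
  -- no block B with B = -B  (the block of i is B = {j ∈ [±n] : j ~ i})
  × (∀ i → i ∈ pm n → ¬ (∀ j → j ∈ pm n → Same Λ j i ⇔ Same Λ (- j) i))

InNCD : ℕ → Labelling → Set
InNCD n Λ =
  InΠD n Λ ×
  (∀ i j k l → Arc n Λ i k → Arc n Λ j l → i < j → j < k → k < l →
     (i ≡ - l × k ≡ - j))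

MinusOneMax : ℕ → Labelling → Set
MinusOneMax n Λ = (-[1+ 0 ] ∈ pm n) × MaxInBlock n Λ -[1+ 0 ]

-- Λ⁺ is the partition of [±n] into the chains of the partial map succ⁺ with
-- succ⁺ i = j iff (i,j) ∈ (Arc(Λ) ∖ S) ∪ T.  This map is increasing and injective,
-- so labelling each point by the end of its chain gives a partition whose arcs are
-- exactly the steps of succ⁺ (module Chains).  Blocks of Λ⁺ are counted by chain
-- ends and blocks of Λ by block minima (distinct-labels).  The heart of the
-- argument is a local fact using non-crossing (Counting.consecutive): for
-- consecutive x, x+1 ∈ [±n], x ends its chain in Λ⁺ iff x+1 is not minimal in its
-- block of Λ.  Summed over the runs −n,…,−1 and 1,…,n the indicators telescope,
-- leaving boundary terms at ±1 and ±n; the symmetry −Λ = Λ identifies the terms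
-- at ±1 with [−1 is maximal].  So |Λ⁺| + |Λ| = 2n + 2·[−1 is maximal] (blocks-sum).
module Submission where

open import Defs
open import Data.Nat as N using (ℕ; zero; suc; _*_; _∸_)
import Data.Nat.Properties as NP
open import Data.Nat.ListAction using (sum)
open import Data.Nat.ListAction.Properties using (sum-++)
open import Data.Nat.Tactic.RingSolver using (solve-∀)
open import Data.Integer as Z using (ℤ; +_; -[1+_]; -_; 1ℤ; _<_; _≤_; _+_)
import Data.Integer.Properties as ZP
open import Data.List using (List; []; _∷_; [_]; map; _++_; upTo; length; deduplicate; filter)
import Data.List.Properties as LP
open import Data.List.Membership.Propositional using (_∈_; _∉_)
open import Data.List.Membership.Propositional.Properties
  using (∈-++⁻; ∈-++⁺ˡ; ∈-++⁺ʳ; ∈-map⁻; ∈-map⁺; ∈-upTo⁺; ∈-upTo⁻; ∈-filter⁺; ∈-filter⁻;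
         ∈-deduplicate⁺; ∈-deduplicate⁻)
open import Data.List.Membership.DecPropositional Z._≟_ using (_∈?_)
open import Data.List.Relation.Unary.Any as Any using (here; there)
import Data.List.Relation.Unary.All as All
import Data.List.Relation.Unary.All.Properties as AllP
open import Data.List.Relation.Unary.AllPairs using ([]; _∷_)
open import Data.List.Relation.Unary.Unique.Propositional using (Unique)
import Data.List.Relation.Unary.Unique.Propositional.Properties as UniqueP
import Data.List.Relation.Unary.Unique.DecPropositional.Properties N._≟_ as DedupP
open import Data.Maybe using (Maybe; just; nothing; maybe′)
import Data.Maybe.Properties as MaybeP
open import Data.Product using (_×_; Σ; _,_; proj₁; proj₂; ∃)
open import Data.Sum using (_⊎_; inj₁; inj₂)
open import Data.Empty using (⊥; ⊥-elim)
open import Function using (_∘_)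
open import Function.Bundles using (_⇔_; mk⇔; Equivalence)
open import Function.Properties.Equivalence using () renaming (trans to ⇔-trans; sym to ⇔-sym)
open import Relation.Binary using (DecTotalOrder)
open import Relation.Binary.Definitions using (tri<; tri≈; tri>)
import Relation.Binary.Construct.Flip.EqAndOrd as Flip
open import Relation.Binary.PropositionalEquality hiding ([_])
open import Relation.Nullary using (¬_; Dec; yes; no; ¬?)
open import Relation.Nullary.Decidable using (_×-dec_)
open import Relation.Unary using (Decidable)
open import Algebra.Bundles using (AbelianGroup)
open import Algebra.Properties.Group (AbelianGroup.group ZP.+-0-abelianGroup) using (∙-cancelʳ)

open Equivalence using (to; from)

i<i+1 : ∀ i → i < i + 1ℤ
i<i+1 i = subst (i <_) (ZP.+-comm 1ℤ i) (ZP.suc[i]≤j⇒i<j ZP.≤-refl)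

i<j⇒i+1≤j : ∀ {i j} → i < j → i + 1ℤ ≤ j
i<j⇒i+1≤j {i} i<j = subst (_≤ _) (ZP.+-comm 1ℤ i) (ZP.i<j⇒suc[i]≤j i<j)

nothing-between : ∀ {i j} → i < j → j < i + 1ℤ → ⊥
nothing-between i<j j<i+1 = ZP.<⇒≱ j<i+1 (i<j⇒i+1≤j i<j)

below-succ : ∀ {q x} → q < x + 1ℤ → q ≢ x → q < x
below-succ q<x+1 q≢x = ZP.≤∧≢⇒< (ZP.≮⇒≥ (λ x<q → nothing-between x<q q<x+1)) q≢x

+1-injective : ∀ {a b} → a + 1ℤ ≡ b + 1ℤ → a ≡ b
+1-injective {a} {b} = ∙-cancelʳ 1ℤ a b

-- x and x + 1 have different parities, so they are never opposite.
succ≢neg : ∀ x → x + 1ℤ ≢ - x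
succ≢neg (+ zero) ()
succ≢neg (+ suc k) ()
succ≢neg -[1+ zero ] ()
succ≢neg -[1+ suc k ] ()

data InPM (n : ℕ) : ℤ → Set where
  neg : ∀ k → k N.< n → InPM n -[1+ k ]
  pos : ∀ k → k N.< n → InPM n (+ suc k)

pm⁻ : ∀ {n x} → x ∈ pm n → InPM n x
pm⁻ {n} x∈ with ∈-++⁻ (map (λ k → -[1+ k ]) (upTo n)) x∈
... | inj₁ p with ∈-map⁻ (λ k → -[1+ k ]) p
...   | k , k∈ , refl = neg k (∈-upTo⁻ k∈)
pm⁻ {n} x∈ | inj₂ p with ∈-map⁻ (λ k → + suc k) p
...   | k , k∈ , refl = pos k (∈-upTo⁻ k∈)

pm⁺ : ∀ {n x} → InPM n x → x ∈ pm n
pm⁺ {n} (neg k k<n) = ∈-++⁺ˡ (∈-map⁺ (λ k → -[1+ k ]) (∈-upTo⁺ k<n))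
pm⁺ {n} (pos k k<n) = ∈-++⁺ʳ (map (λ k → -[1+ k ]) (upTo n)) (∈-map⁺ (λ k → + suc k) (∈-upTo⁺ k<n))

pm-neg : ∀ {n x} → x ∈ pm n → - x ∈ pm n
pm-neg {n} x∈ with pm⁻ {n} x∈
... | neg k k<n = pm⁺ (pos k k<n)
... | pos k k<n = pm⁺ (neg k k<n)

0∉pm : ∀ {n} → + 0 ∉ pm n
0∉pm {n} x∈ with pm⁻ {n} x∈
... | ()

pm-≤ : ∀ {n x} → x ∈ pm n → x ≤ + n
pm-≤ {n} x∈ with pm⁻ {n} x∈
... | neg _ _ = Z.-≤+
... | pos _ k<n = Z.+≤+ k<n

pm-≥ : ∀ {m x} → x ∈ pm (suc m) → -[1+ m ] ≤ x
pm-≥ {m} x∈ with pm⁻ {suc m} x∈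
... | neg _ k<n = Z.-≤- (NP.≤-pred k<n)
... | pos _ _ = Z.-≤+

pm-unique : ∀ n → Unique (pm n)
pm-unique n = UniqueP.++⁺ (UniqueP.map⁺ ZP.-[1+-injective (UniqueP.upTo⁺ n))
                         (UniqueP.map⁺ (NP.suc-injective ∘ ZP.+-injective) (UniqueP.upTo⁺ n)) disjoint
  where
  disjoint : ∀ {v} → ¬ (v ∈ map (λ k → -[1+ k ]) (upTo n) × v ∈ map (λ k → + suc k) (upTo n))
  disjoint (a , b) with ∈-map⁻ (λ k → -[1+ k ]) a | ∈-map⁻ (λ k → + suc k) b
  ... | _ , _ , refl | _ , _ , ()

-- Distance below n; strictly antitone on integers ≤ n.  It is used both as a
-- termination measure for following chains and as an injective labelling.
rank : ℕ → ℤ → ℕ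
rank n (+ k) = n ∸ k
rank n -[1+ k ] = n N.+ suc k

rank-antitone : ∀ {n i j} → i < j → j ≤ + n → rank n j N.< rank n i
rank-antitone {n} (Z.-<- k<m) _ = NP.+-monoʳ-< n (N.s≤s k<m)
rank-antitone {n} {j = + k} Z.-<+ _ = NP.≤-<-trans (NP.m∸n≤m n k) (NP.m<m+n n (N.s≤s N.z≤n))
rank-antitone (Z.+<+ a<b) (Z.+≤+ b≤n) = NP.∸-monoʳ-< a<b b≤n

module Extremum {a ℓ₁ ℓ₂} (O : DecTotalOrder a ℓ₁ ℓ₂) where
  open DecTotalOrder O renaming (Carrier to A; _≤_ to _≼_; refl to ≼-refl; trans to ≼-trans)

  IsLeast : ∀ {p} → List A → (A → Set p) → A → Set _
  IsLeast L P m = m ∈ L × P m × (∀ x → x ∈ L → P x → m ≼ x)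

  least? : ∀ {p} {P : A → Set p} → Decidable P → ∀ L →
           (∀ x → x ∈ L → ¬ P x) ⊎ ∃ (IsLeast L P)
  least? P? [] = inj₁ (λ _ ())
  least? P? (y ∷ ys) with P? y | least? P? ys
  ... | no ¬py | inj₁ none = inj₁ λ { x (here refl) → ¬py ; x (there x∈) → none x x∈ }
  ... | no ¬py | inj₂ (m , m∈ , pm , min) =
    inj₂ (m , there m∈ , pm , λ { x (here refl) px → ⊥-elim (¬py px) ; x (there x∈) → min x x∈ })
  ... | yes py | inj₁ none =
    inj₂ (y , here refl , py , λ { x (here refl) _ → ≼-refl ; x (there x∈) px → ⊥-elim (none x x∈ px) })
  ... | yes py | inj₂ (m , m∈ , pm , min) with total y m
  ...   | inj₁ y≤m =
    inj₂ (y , here refl , py , λ { x (here refl) _ → ≼-refl ; x (there x∈) px → ≼-trans y≤m (min x x∈ px) })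
  ...   | inj₂ m≤y =
    inj₂ (m , there m∈ , pm , λ { x (here refl) _ → m≤y ; x (there x∈) px → min x x∈ px })

open Extremum ZP.≤-decTotalOrder using (IsLeast; least?)
open Extremum (Flip.decTotalOrder ZP.≤-decTotalOrder)
  using () renaming (IsLeast to IsGreatest; least? to greatest?)

least-unique : ∀ {L} {P : ℤ → Set} {a b} → IsLeast L P a → IsLeast L P b → a ≡ b
least-unique (a∈ , pa , a-min) (b∈ , pb , b-min) = ZP.≤-antisym (a-min _ b∈ pb) (b-min _ a∈ pa)

greatest-unique : ∀ {L} {P : ℤ → Set} {a b} → IsGreatest L P a → IsGreatest L P b → a ≡ b
greatest-unique (a∈ , pa , a-max) (b∈ , pb , b-max) = ZP.≤-antisym (b-max _ a∈ pa) (a-max _ b∈ pb)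

𝟙 : ∀ {p} {P : Set p} → Dec P → ℕ
𝟙 (yes _) = 1
𝟙 (no _) = 0

𝟙-yes : ∀ {p} {P : Set p} → P → (d : Dec P) → 𝟙 d ≡ 1
𝟙-yes _ (yes _) = refl
𝟙-yes p (no ¬p) = ⊥-elim (¬p p)

𝟙-no : ∀ {p} {P : Set p} → ¬ P → (d : Dec P) → 𝟙 d ≡ 0
𝟙-no ¬p (yes p) = ⊥-elim (¬p p)
𝟙-no _ (no _) = refl

𝟙-cong : ∀ {p q} {P : Set p} {Q : Set q} → P ⇔ Q → (d : Dec P) (e : Dec Q) → 𝟙 d ≡ 𝟙 e
𝟙-cong P⇔Q (yes p) e = sym (𝟙-yes (to P⇔Q p) e)
𝟙-cong P⇔Q (no ¬p) e = sym (𝟙-no (¬p ∘ from P⇔Q) e)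

𝟙-exactly-one : ∀ {p q} {P : Set p} {Q : Set q} → (Q → ¬ P) → (¬ Q → P) →
                (d : Dec P) (e : Dec Q) → 𝟙 d N.+ 𝟙 e ≡ 1
𝟙-exactly-one Q⇒¬P _ (yes p) (yes q) = ⊥-elim (Q⇒¬P q p)
𝟙-exactly-one _ _ (yes _) (no _) = refl
𝟙-exactly-one _ _ (no _) (yes _) = refl
𝟙-exactly-one _ ¬Q⇒P (no ¬p) (no ¬q) = ⊥-elim (¬p (¬Q⇒P ¬q))

count-filter : ∀ {A : Set} {R : A → Set} (R? : Decidable R) (L : List A) →
               length (filter R? L) ≡ sum (map (λ x → 𝟙 (R? x)) L)
count-filter R? [] = refl
count-filter R? (x ∷ xs) with R? x
... | yes _ = cong suc (count-filter R? xs)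
... | no _ = count-filter R? xs

unique-length-≤ : ∀ {xs ys : List ℕ} → Unique xs → (∀ {z} → z ∈ xs → z ∈ ys) → length xs N.≤ length ys
unique-length-≤ {[]} _ _ = N.z≤n
unique-length-≤ {x ∷ xs} {ys} (x∉xs ∷ unique-xs) xs⊆ys =
  NP.<-≤-trans (N.s≤s (unique-length-≤ unique-xs xs⊆others))
               (LP.filter-notAll (λ y → ¬? (x N.≟ y)) ys (Any.map (λ x≡y x≢y → x≢y x≡y) (xs⊆ys (here refl))))
  where
  xs⊆others : ∀ {z} → z ∈ xs → z ∈ filter (λ y → ¬? (x N.≟ y)) ys
  xs⊆others z∈ = ∈-filter⁺ (λ y → ¬? (x N.≟ y)) (xs⊆ys (there z∈)) (All.lookup x∉xs z∈)

unique-length-≡ : ∀ {xs ys : List ℕ} → Unique xs → Unique ys →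
                  (∀ {z} → z ∈ xs → z ∈ ys) → (∀ {z} → z ∈ ys → z ∈ xs) → length xs ≡ length ys
unique-length-≡ ux uy xs⊆ys ys⊆xs = NP.≤-antisym (unique-length-≤ ux xs⊆ys) (unique-length-≤ uy ys⊆xs)

map-unique : ∀ {A : Set} (g : A → ℕ) {L : List A} → Unique L →
             (∀ {x y} → x ∈ L → y ∈ L → g x ≡ g y → x ≡ y) → Unique (map g L)
map-unique g {[]} [] _ = []
map-unique g {x ∷ xs} (x∉xs ∷ unique-xs) inj =
  AllP.map⁺ (All.tabulate (λ y∈ gx≡gy → All.lookup x∉xs y∈ (inj (here refl) (there y∈) gx≡gy)))
  ∷ map-unique g unique-xs (λ a∈ b∈ → inj (there a∈) (there b∈))

distinct-labels : ∀ {A : Set} (g : A → ℕ) {R : A → Set} (R? : Decidable R) (L : List A) → Unique L →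
  (∀ {x y} → x ∈ L → y ∈ L → R x → R y → g x ≡ g y → x ≡ y) →
  (∀ {x} → x ∈ L → ∃ λ y → y ∈ L × R y × g y ≡ g x) →
  length (deduplicate N._≟_ (map g L)) ≡ sum (map (λ x → 𝟙 (R? x)) L)
distinct-labels g {R} R? L unique-L reps-injective reps-cover = begin
  length (deduplicate N._≟_ (map g L))
    ≡⟨ unique-length-≡ (DedupP.deduplicate-! (map g L)) unique-reps labels⊆reps reps⊆labels ⟩
  length (map g (filter R? L))        ≡⟨ LP.length-map g (filter R? L) ⟩
  length (filter R? L)                ≡⟨ count-filter R? L ⟩
  sum (map (λ x → 𝟙 (R? x)) L)        ∎
  where
  open ≡-Reasoning
  in-filter : ∀ {x} → x ∈ filter R? L → x ∈ L × R x
  in-filter = ∈-filter⁻ R? {xs = L}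
  unique-reps : Unique (map g (filter R? L))
  unique-reps = map-unique g (UniqueP.filter⁺ R? unique-L) λ x∈ y∈ →
    reps-injective (proj₁ (in-filter x∈)) (proj₁ (in-filter y∈)) (proj₂ (in-filter x∈)) (proj₂ (in-filter y∈))
  labels⊆reps : ∀ {z} → z ∈ deduplicate N._≟_ (map g L) → z ∈ map g (filter R? L)
  labels⊆reps z∈ with ∈-map⁻ g (∈-deduplicate⁻ N._≟_ (map g L) z∈)
  ... | x , x∈ , refl with reps-cover x∈
  ...   | y , y∈ , ry , gy≡gx = subst (_∈ map g (filter R? L)) gy≡gx (∈-map⁺ g (∈-filter⁺ R? y∈ ry))
  reps⊆labels : ∀ {z} → z ∈ map g (filter R? L) → z ∈ deduplicate N._≟_ (map g L)
  reps⊆labels z∈ with ∈-map⁻ g z∈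
  ... | x , x∈ , refl = ∈-deduplicate⁺ N._≟_ (∈-map⁺ g (proj₁ (in-filter x∈)))

sum-map-+ : ∀ {A : Set} (f g : A → ℕ) (L : List A) →
            sum (map (λ x → f x N.+ g x) L) ≡ sum (map f L) N.+ sum (map g L)
sum-map-+ f g [] = refl
sum-map-+ f g (x ∷ xs) rewrite sum-map-+ f g xs = interchange (f x) (g x) (sum (map f xs)) (sum (map g xs))
  where
  interchange : ∀ a b c d → a N.+ b N.+ (c N.+ d) ≡ a N.+ c N.+ (b N.+ d)
  interchange = solve-∀

sum-pm : ∀ (f : ℤ → ℕ) n →
  sum (map f (pm n)) ≡ sum (map (λ k → f -[1+ k ]) (upTo n)) N.+ sum (map (λ k → f (+ suc k)) (upTo n))
sum-pm f n = begin
  sum (map f (negatives ++ positives))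
    ≡⟨ cong sum (LP.map-++ f negatives positives) ⟩
  sum (map f negatives ++ map f positives)
    ≡⟨ sum-++ (map f negatives) (map f positives) ⟩
  sum (map f negatives) N.+ sum (map f positives)
    ≡⟨ cong₂ N._+_ (cong sum (LP.map-∘ (upTo n))) (cong sum (LP.map-∘ (upTo n))) ⟨
  sum (map (λ k → f -[1+ k ]) (upTo n)) N.+ sum (map (λ k → f (+ suc k)) (upTo n)) ∎
  where
  open ≡-Reasoning
  negatives = map (λ k → -[1+ k ]) (upTo n)
  positives = map (λ k → + suc k) (upTo n)

sum-upTo-suc : ∀ (f : ℕ → ℕ) m → sum (map f (upTo (suc m))) ≡ sum (map f (upTo m)) N.+ f m
sum-upTo-suc f m = begin
  sum (map f (upTo (suc m)))              ≡⟨ cong (sum ∘ map f) (LP.upTo-∷ʳ m) ⟨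
  sum (map f (upTo m ++ [ m ]))           ≡⟨ cong sum (LP.map-++ f (upTo m) [ m ]) ⟩
  sum (map f (upTo m) ++ [ f m ])         ≡⟨ sum-++ (map f (upTo m)) [ f m ] ⟩
  sum (map f (upTo m)) N.+ (f m N.+ 0)    ≡⟨ cong (sum (map f (upTo m)) N.+_) (NP.+-identityʳ (f m)) ⟩
  sum (map f (upTo m)) N.+ f m            ∎
  where open ≡-Reasoning

telescope : ∀ (a b : ℕ → ℕ) m → (∀ k → k N.< m → a k N.+ b (suc k) ≡ 1) →
            sum (map (λ k → a k N.+ b k) (upTo (suc m))) ≡ b 0 N.+ m N.+ a m
telescope a b zero _ = swap (a 0) (b 0)
  where
  swap : ∀ x y → x N.+ y N.+ 0 ≡ y N.+ 0 N.+ x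
  swap = solve-∀
telescope a b (suc m) adjacent = begin
  sum (map (λ k → a k N.+ b k) (upTo (suc (suc m))))
    ≡⟨ sum-upTo-suc (λ k → a k N.+ b k) (suc m) ⟩
  sum (map (λ k → a k N.+ b k) (upTo (suc m))) N.+ (a (suc m) N.+ b (suc m))
    ≡⟨ cong (N._+ (a (suc m) N.+ b (suc m))) (telescope a b m (λ k k<m → adjacent k (NP.m≤n⇒m≤1+n k<m))) ⟩
  b 0 N.+ m N.+ a m N.+ (a (suc m) N.+ b (suc m))
    ≡⟨ regroup (b 0) m (a m) (a (suc m)) (b (suc m)) ⟩
  b 0 N.+ m N.+ (a m N.+ b (suc m)) N.+ a (suc m)
    ≡⟨ cong (λ t → b 0 N.+ m N.+ t N.+ a (suc m)) (adjacent m NP.≤-refl) ⟩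
  b 0 N.+ m N.+ 1 N.+ a (suc m)
    ≡⟨ cong (N._+ a (suc m)) (regroup-1 (b 0) m) ⟩
  b 0 N.+ suc m N.+ a (suc m) ∎
  where
  open ≡-Reasoning
  regroup : ∀ b₀ m x y z → b₀ N.+ m N.+ x N.+ (y N.+ z) ≡ b₀ N.+ m N.+ (x N.+ z) N.+ y
  regroup = solve-∀
  regroup-1 : ∀ b₀ m → b₀ N.+ m N.+ 1 ≡ b₀ N.+ suc m
  regroup-1 = solve-∀

Later : Labelling → ℤ → ℤ → Set
Later Λ i x = i < x × Same Λ i x

Later? : ∀ Λ i → Decidable (Later Λ i)
Later? Λ i x = (i Z.<? x) ×-dec (Λ i N.≟ Λ x)

Earlier : Labelling → ℤ → ℤ → Set
Earlier Λ j x = x < j × Same Λ x j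

Earlier? : ∀ Λ j → Decidable (Earlier Λ j)
Earlier? Λ j x = (x Z.<? j) ×-dec (Λ x N.≟ Λ j)

-- The partition into chains of a partial successor map s on a finite X ⊆ ℤ.  The rank function only has to be strictly antitone on X;
-- it bounds chain lengths and turns chain ends into labels.

module Chains (X : List ℤ) (s : ℤ → Maybe ℤ) (rank : ℤ → ℕ)
  (s-in : ∀ {i j} → s i ≡ just j → j ∈ X)
  (s-increasing : ∀ {i j} → s i ≡ just j → i < j)
  (s-injective : ∀ {a b j} → a ∈ X → b ∈ X → s a ≡ just j → s b ≡ just j → a ≡ b)
  (rank-antitone : ∀ {i j} → i < j → j ∈ X → rank j N.< rank i) where

  s-rank : ∀ {i j} → s i ≡ just j → rank j N.< rank i
  s-rank e = rank-antitone (s-increasing e) (s-in e)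

  rank-injective : ∀ {x y} → x ∈ X → y ∈ X → rank x ≡ rank y → x ≡ y
  rank-injective {x} {y} x∈ y∈ e with ZP.<-cmp x y
  ... | tri< x<y _ _ = ⊥-elim (NP.<⇒≢ (rank-antitone x<y y∈) (sym e))
  ... | tri≈ _ x≡y _ = x≡y
  ... | tri> _ _ y<x = ⊥-elim (NP.<⇒≢ (rank-antitone y<x x∈) e)

  data Reach : ℤ → ℤ → Set where
    start : ∀ {a} → Reach a a
    step  : ∀ {a b c} → s a ≡ just b → Reach b c → Reach a c

  reach-≤ : ∀ {a c} → Reach a c → a ≤ c
  reach-≤ start = ZP.≤-refl
  reach-≤ (step e r) = ZP.≤-trans (ZP.<⇒≤ (s-increasing e)) (reach-≤ r)

  reach-in : ∀ {a c} → a ∈ X → Reach a c → c ∈ X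
  reach-in a∈ start = a∈
  reach-in a∈ (step e r) = reach-in (s-in e) r

  reach-last : ∀ {a c} → Reach a c → a ≡ c ⊎ ∃ (λ d → Reach a d × s d ≡ just c)
  reach-last start = inj₁ refl
  reach-last {a} (step e r) with reach-last r
  ... | inj₁ refl = inj₂ (a , start , e)
  ... | inj₂ (d , r′ , e′) = inj₂ (d , step e r′ , e′)

  -- By injectivity of s, two paths into the same point are nested.
  reach-comparable : ∀ {a b t} → a ∈ X → b ∈ X → Reach a t → Reach b t → Reach a b ⊎ Reach b a
  reach-comparable a∈ b∈ start rb = inj₂ rb
  reach-comparable a∈ b∈ (step e r) rb with reach-comparable (s-in e) b∈ r rb
  ... | inj₁ r′ = inj₁ (step e r′)
  ... | inj₂ r′ with reach-last r′
  ...   | inj₁ refl = inj₁ (step e start)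
  ...   | inj₂ (d , r″ , e′) = inj₂ (subst (Reach _) (s-injective (reach-in b∈ r″) a∈ e′ e) r″)

  -- Following s for at most f steps; f > rank i steps always reach the chain end.
  follow : ℕ → ℤ → ℤ
  follow zero i = i
  follow (suc f) i = maybe′ (follow f) i (s i)

  follow-enough : ∀ f g i → rank i N.< f → rank i N.< g → follow f i ≡ follow g i
  follow-enough (suc f) (suc g) i (N.s≤s i<f) (N.s≤s i<g) with s i in e
  ... | nothing = refl
  ... | just j = follow-enough f g j (NP.<-≤-trans (s-rank e) i<f) (NP.<-≤-trans (s-rank e) i<g)

  follow-reaches-end : ∀ f i → rank i N.< f → Reach i (follow f i) × s (follow f i) ≡ nothing
  follow-reaches-end (suc f) i (N.s≤s i<f) with s i in e
  ... | nothing = start , e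
  ... | just j with follow-reaches-end f j (NP.<-≤-trans (s-rank e) i<f)
  ...   | r , at-end = step e r , at-end

  end : ℤ → ℤ
  end i = follow (suc (rank i)) i

  end-reached : ∀ i → Reach i (end i) × s (end i) ≡ nothing
  end-reached i = follow-reaches-end (suc (rank i)) i NP.≤-refl

  end-step : ∀ {i j} → s i ≡ just j → end i ≡ end j
  end-step {i} {j} e rewrite e = follow-enough (rank i) (suc (rank j)) j (s-rank e) NP.≤-refl

  end-fixed : ∀ {i} → s i ≡ nothing → end i ≡ i
  end-fixed e rewrite e = refl

  same-end⇒reach : ∀ {i x} → i ∈ X → x ∈ X → i < x → end i ≡ end x → Reach i x
  same-end⇒reach {i} {x} i∈ x∈ i<x e
    with reach-comparable i∈ x∈ (proj₁ (end-reached i)) (subst (Reach x) (sym e) (proj₁ (end-reached x)))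
  ... | inj₁ r = r
  ... | inj₂ r = ⊥-elim (ZP.<⇒≱ i<x (reach-≤ r))

  label : Labelling
  label i = rank (end i)

  same-label⇒same-end : ∀ {i x} → i ∈ X → x ∈ X → label i ≡ label x → end i ≡ end x
  same-label⇒same-end i∈ x∈ =
    rank-injective (reach-in i∈ (proj₁ (end-reached _))) (reach-in x∈ (proj₁ (end-reached _)))

  successor⇔least : ∀ {i j} → i ∈ X → s i ≡ just j ⇔ IsLeast X (Later label i) j
  successor⇔least {i} {j} i∈ = mk⇔ successor-least least-successor
    where
    successor-least : s i ≡ just j → IsLeast X (Later label i) j
    successor-least e = s-in e , (s-increasing e , cong rank (end-step e)) , least
      where
      least : ∀ x → x ∈ X → Later label i x → j ≤ x
      least x x∈ (i<x , same) with same-end⇒reach i∈ x∈ i<x (same-label⇒same-end i∈ x∈ same)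
      ... | start = ⊥-elim (ZP.<-irrefl refl i<x)
      ... | step e′ r with trans (sym e) e′
      ...   | refl = reach-≤ r
    least-successor : IsLeast X (Later label i) j → s i ≡ just j
    least-successor (j∈ , (i<j , same) , least)
      with same-end⇒reach i∈ j∈ i<j (same-label⇒same-end i∈ j∈ same)
    ... | start = ⊥-elim (ZP.<-irrefl refl i<j)
    ... | step {b = b} e r =
      subst (λ z → s i ≡ just z) (ZP.≤-antisym (reach-≤ r) (least b (s-in e) (s-increasing e , cong rank (end-step e)))) e

  end-represents : ∀ {x} → x ∈ X → ∃ λ y → y ∈ X × s y ≡ nothing × label y ≡ label x
  end-represents {x} x∈ with end-reached x
  ... | r , at-end = end x , reach-in x∈ r , at-end , cong rank (end-fixed at-end)

  ends-injective : ∀ {x y} → x ∈ X → y ∈ X → s x ≡ nothing → s y ≡ nothing → label x ≡ label y → x ≡ y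
  ends-injective x∈ y∈ x-end y-end same =
    trans (sym (end-fixed x-end)) (trans (same-label⇒same-end x∈ y∈ same) (end-fixed y-end))

module Arcs (n : ℕ) (Λ : Labelling) where
  X : List ℤ
  X = pm n

  arc⇔least : ∀ {i j} → i ∈ X → Arc n Λ i j ⇔ IsLeast X (Later Λ i) j
  arc⇔least i∈ = mk⇔
    (λ { (_ , j∈ , i<j , same , gap) →
           j∈ , (i<j , same) , λ x x∈ (i<x , s) → ZP.≮⇒≥ (λ x<j → gap x x∈ i<x x<j s) })
    (λ { (j∈ , (i<j , same) , least) →
           i∈ , j∈ , i<j , same , λ k k∈ i<k k<j s → ZP.<⇒≱ k<j (least k k∈ (i<k , s)) })

  arc⇔greatest : ∀ {i j} → j ∈ X → Arc n Λ i j ⇔ IsGreatest X (Earlier Λ j) i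
  arc⇔greatest j∈ = mk⇔
    (λ { (i∈ , _ , i<j , same , gap) →
           i∈ , (i<j , same) , λ x x∈ (x<j , e) → ZP.≮⇒≥ (λ i<x → gap x x∈ i<x x<j (trans same (sym e))) })
    (λ { (i∈ , (i<j , same) , greatest) →
           i∈ , j∈ , i<j , same , λ k k∈ i<k k<j s → ZP.<⇒≱ i<k (greatest k k∈ (k<j , trans (sym s) same)) })

  arc-functional : ∀ {i j k} → Arc n Λ i j → Arc n Λ i k → j ≡ k
  arc-functional arc-ij arc-ik =
    least-unique (to (arc⇔least (proj₁ arc-ij)) arc-ij) (to (arc⇔least (proj₁ arc-ik)) arc-ik)

  arc-injective : ∀ {i j k} → Arc n Λ i k → Arc n Λ j k → i ≡ j
  arc-injective arc-ik arc-jk =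
    greatest-unique (to (arc⇔greatest (proj₁ (proj₂ arc-ik))) arc-ik) (to (arc⇔greatest (proj₁ (proj₂ arc-jk))) arc-jk)

  arc⇒¬max : ∀ {i j} → Arc n Λ i j → ¬ MaxInBlock n Λ i
  arc⇒¬max (_ , j∈ , i<j , same , _) max = ZP.<⇒≱ i<j (max _ j∈ same)

  arc⇒¬min : ∀ {i j} → Arc n Λ i j → ¬ MinInBlock n Λ j
  arc⇒¬min (i∈ , _ , i<j , same , _) min = ZP.<⇒≱ i<j (min _ i∈ (sym same))

  nothing-later⇒max : ∀ {i} → (∀ x → x ∈ X → ¬ Later Λ i x) → MaxInBlock n Λ i
  nothing-later⇒max none j j∈ same = ZP.≮⇒≥ (λ i<j → none j j∈ (i<j , same))

  nothing-earlier⇒min : ∀ {j} → (∀ x → x ∈ X → ¬ Earlier Λ j x) → MinInBlock n Λ j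
  nothing-earlier⇒min none x x∈ same = ZP.≮⇒≥ (λ x<j → none x x∈ (x<j , sym same))

  max-or-arc : ∀ {i} → i ∈ X → MaxInBlock n Λ i ⊎ ∃ (Arc n Λ i)
  max-or-arc {i} i∈ with least? (Later? Λ i) X
  ... | inj₁ none = inj₁ (nothing-later⇒max none)
  ... | inj₂ (m , least) = inj₂ (m , from (arc⇔least i∈) least)

  min-or-arc : ∀ {j} → j ∈ X → MinInBlock n Λ j ⊎ ∃ (λ i → Arc n Λ i j)
  min-or-arc {j} j∈ with greatest? (Earlier? Λ j) X
  ... | inj₁ none = inj₁ (nothing-earlier⇒min none)
  ... | inj₂ (q , greatest) = inj₂ (q , from (arc⇔greatest j∈) greatest)

  max? : ∀ i → Dec (MaxInBlock n Λ i)
  max? i with least? (Later? Λ i) X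
  ... | inj₁ none = yes (nothing-later⇒max none)
  ... | inj₂ (m , m∈ , (i<m , same) , _) = no λ max → ZP.<⇒≱ i<m (max m m∈ same)

  min? : ∀ j → Dec (MinInBlock n Λ j)
  min? j with greatest? (Earlier? Λ j) X
  ... | inj₁ none = yes (nothing-earlier⇒min none)
  ... | inj₂ (q , q∈ , (q<j , same) , _) = no λ min → ZP.<⇒≱ q<j (min q q∈ (sym same))

  blocks-by-minima : blocks n Λ ≡ sum (map (λ x → 𝟙 (min? x)) X)
  blocks-by-minima = distinct-labels Λ min? X (pm-unique n) minima-injective minimum-exists
    where
    minima-injective : ∀ {x y} → x ∈ X → y ∈ X → MinInBlock n Λ x → MinInBlock n Λ y → Λ x ≡ Λ y → x ≡ y
    minima-injective x∈ y∈ x-min y-min same = ZP.≤-antisym (x-min _ y∈ same) (y-min _ x∈ (sym same))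
    minimum-exists : ∀ {x} → x ∈ X → ∃ λ y → y ∈ X × MinInBlock n Λ y × Λ y ≡ Λ x
    minimum-exists {x} x∈ with least? (λ y → Λ y N.≟ Λ x) X
    ... | inj₁ none = ⊥-elim (none x x∈ refl)
    ... | inj₂ (m , m∈ , same , least) = m , m∈ , (λ y y∈ s → least y y∈ (trans (sym s) same)) , same

module PlusSuccessor (n : ℕ) (Λ : Labelling) where
  open Arcs n Λ

  arcPlus-source : ∀ {i j} → ArcPlus n Λ i j → i ∈ X
  arcPlus-source (inj₁ ((i∈ , _) , _)) = i∈
  arcPlus-source (inj₂ (_ , i∈ , _)) = i∈

  arcPlus-target : ∀ {i j} → ArcPlus n Λ i j → j ∈ X
  arcPlus-target (inj₁ ((_ , j∈ , _) , _)) = j∈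
  arcPlus-target (inj₂ (_ , _ , j∈ , _)) = j∈

  arcPlus-increasing : ∀ {i j} → ArcPlus n Λ i j → i < j
  arcPlus-increasing (inj₁ ((_ , _ , i<j , _) , _)) = i<j
  arcPlus-increasing {i} (inj₂ (refl , _)) = i<i+1 i

  arcPlus-injective : ∀ {a b j} → ArcPlus n Λ a j → ArcPlus n Λ b j → a ≡ b
  arcPlus-injective (inj₁ (arc-a , _)) (inj₁ (arc-b , _)) = arc-injective arc-a arc-b
  arcPlus-injective (inj₁ (arc , _)) (inj₂ (_ , _ , _ , _ , min)) = ⊥-elim (arc⇒¬min arc min)
  arcPlus-injective (inj₂ (_ , _ , _ , _ , min)) (inj₁ (arc , _)) = ⊥-elim (arc⇒¬min arc min)
  arcPlus-injective (inj₂ (a+1≡j , _)) (inj₂ (b+1≡j , _)) = +1-injective (trans (sym a+1≡j) b+1≡j)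

  -- m, unless m = i + 1: the arcs of Λ in S are dropped.
  unlessAdjacent : ∀ i m → Dec (m ≡ i + 1ℤ) → Maybe ℤ
  unlessAdjacent i m (yes _) = nothing
  unlessAdjacent i m (no _) = just m

  -- i + 1, provided it is a point minimal in its block: the arcs of T.
  ifOpening : ∀ i → Dec (i + 1ℤ ∈ X) → Dec (MinInBlock n Λ (i + 1ℤ)) → Maybe ℤ
  ifOpening i (yes _) (yes _) = just (i + 1ℤ)
  ifOpening i (yes _) (no _) = nothing
  ifOpening i (no _) _ = nothing

  next : ∀ i → Dec (i ∈ X) → (∀ x → x ∈ X → ¬ Later Λ i x) ⊎ ∃ (IsLeast X (Later Λ i)) → Maybe ℤ
  next i (no _) _ = nothing
  next i (yes _) (inj₂ (m , _)) = unlessAdjacent i m (m Z.≟ i + 1ℤ)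
  next i (yes _) (inj₁ _) = ifOpening i (i + 1ℤ ∈? X) (min? (i + 1ℤ))

  succ⁺ : ℤ → Maybe ℤ
  succ⁺ i = next i (i ∈? X) (least? (Later? Λ i) X)

  succ⁺-spec : ∀ {i j} → succ⁺ i ≡ just j ⇔ ArcPlus n Λ i j
  succ⁺-spec {i} = mk⇔ (sound (i ∈? X) (least? (Later? Λ i) X)) (complete (i ∈? X) (least? (Later? Λ i) X))
    where
    unlessAdjacent-just : ∀ {m j} d → unlessAdjacent i m d ≡ just j → m ≡ j × m ≢ i + 1ℤ
    unlessAdjacent-just (no m≢) refl = refl , m≢

    unlessAdjacent-other : ∀ {m} → m ≢ i + 1ℤ → ∀ d → unlessAdjacent i m d ≡ just m
    unlessAdjacent-other m≢ (yes m≡) = ⊥-elim (m≢ m≡)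
    unlessAdjacent-other m≢ (no _) = refl

    ifOpening-just : ∀ {j} d d′ → ifOpening i d d′ ≡ just j → j ≡ i + 1ℤ × j ∈ X × MinInBlock n Λ j
    ifOpening-just (yes j∈) (yes min) refl = refl , j∈ , min

    ifOpening-opens : i + 1ℤ ∈ X → MinInBlock n Λ (i + 1ℤ) → ∀ d d′ → ifOpening i d d′ ≡ just (i + 1ℤ)
    ifOpening-opens _ _ (yes _) (yes _) = refl
    ifOpening-opens _ min (yes _) (no ¬min) = ⊥-elim (¬min min)
    ifOpening-opens j∈ _ (no j∉) _ = ⊥-elim (j∉ j∈)

    sound : ∀ {j} d r → next i d r ≡ just j → ArcPlus n Λ i j
    sound (yes i∈) (inj₂ (m , least)) e with unlessAdjacent-just (m Z.≟ i + 1ℤ) e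
    ... | refl , m≢ = inj₁ (from (arc⇔least i∈) least , m≢)
    sound (yes i∈) (inj₁ none) e with ifOpening-just (i + 1ℤ ∈? X) (min? (i + 1ℤ)) e
    ... | refl , j∈ , min = inj₂ (refl , i∈ , j∈ , nothing-later⇒max none , min)

    complete : ∀ {j} d r → ArcPlus n Λ i j → next i d r ≡ just j
    complete (no i∉) _ ap = ⊥-elim (i∉ (arcPlus-source ap))
    complete (yes i∈) (inj₂ (m , least)) (inj₁ (arc , j≢)) with least-unique least (to (arc⇔least i∈) arc)
    ... | refl = unlessAdjacent-other j≢ (m Z.≟ i + 1ℤ)
    complete (yes i∈) (inj₁ none) (inj₁ (arc , _)) = ⊥-elim (arc⇒¬max arc (nothing-later⇒max none))
    complete (yes i∈) (inj₂ (m , m∈ , (i<m , same) , _)) (inj₂ (_ , _ , _ , max , _)) =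
      ⊥-elim (ZP.<⇒≱ i<m (max m m∈ same))
    complete (yes i∈) (inj₁ _) (inj₂ (refl , _ , j∈ , _ , min)) =
      ifOpening-opens j∈ min (i + 1ℤ ∈? X) (min? (i + 1ℤ))

  ChainEnd : ℤ → Set
  ChainEnd i = succ⁺ i ≡ nothing

  end? : Decidable ChainEnd
  end? i = MaybeP.≡-dec Z._≟_ (succ⁺ i) nothing

  end⇔no-arcPlus : ∀ {i} → ChainEnd i ⇔ (∀ j → ¬ ArcPlus n Λ i j)
  end⇔no-arcPlus {i} = mk⇔ (λ at-end j ap → just≢nothing (trans (sym (from succ⁺-spec ap)) at-end)) no-arc⇒end
    where
    just≢nothing : ∀ {j} → just j ≢ nothing
    just≢nothing ()
    no-arc⇒end : (∀ j → ¬ ArcPlus n Λ i j) → ChainEnd i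
    no-arc⇒end none with succ⁺ i in e
    ... | nothing = refl
    ... | just j = ⊥-elim (none j (to succ⁺-spec e))

module Plus (n : ℕ) (Λ : Labelling) where
  open Arcs n Λ
  open PlusSuccessor n Λ public
  open Chains X succ⁺ (rank n)
    (λ e → arcPlus-target (to succ⁺-spec e)) (λ e → arcPlus-increasing (to succ⁺-spec e))
    (λ _ _ ea eb → arcPlus-injective (to succ⁺-spec ea) (to succ⁺-spec eb))
    (λ i<j j∈ → rank-antitone i<j (pm-≤ j∈))

  Λ⁺ : Labelling
  Λ⁺ = label

  arcs⁺ : ∀ {i j} → i ∈ X → Arc n Λ⁺ i j ⇔ ArcPlus n Λ i j
  arcs⁺ i∈ = ⇔-trans (Arcs.arc⇔least n Λ⁺ i∈) (⇔-trans (⇔-sym (successor⇔least i∈)) succ⁺-spec)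

  blocks⁺-by-ends : blocks n Λ⁺ ≡ sum (map (λ x → 𝟙 (end? x)) X)
  blocks⁺-by-ends = distinct-labels Λ⁺ end? X (pm-unique n) ends-injective end-represents

minusOneMax? : ∀ n Λ → Dec (MinusOneMax n Λ)
minusOneMax? n Λ = (-[1+ 0 ] ∈? pm n) ×-dec Arcs.max? n Λ -[1+ 0 ]

module Counting (m : ℕ) (Λ : Labelling) (nc : InNCD (suc m) Λ) where
  n : ℕ
  n = suc m

  open Arcs n Λ
  open Plus n Λ

  -1∈X : -[1+ 0 ] ∈ X
  -1∈X = pm⁺ (neg 0 (N.s≤s N.z≤n))

  -- If x + 1 opens a block of Λ, then x continues in Λ⁺: either along its arc
  -- of Λ (which is not (x,x+1)), or, if x closes its block, by the arc (x,x+1) ∈ T.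
  opens⇒¬end : ∀ {x} → x ∈ X → x + 1ℤ ∈ X → MinInBlock n Λ (x + 1ℤ) → ¬ ChainEnd x
  opens⇒¬end {x} x∈ y∈ y-min at-end with max-or-arc x∈
  ... | inj₁ x-max = to end⇔no-arcPlus at-end (x + 1ℤ) (inj₂ (refl , x∈ , y∈ , x-max , y-min))
  ... | inj₂ (j , arc) = to end⇔no-arcPlus at-end j (inj₁ (arc , λ { refl → arc⇒¬min arc y-min }))

  -- If x + 1 does not open a block, it ends an arc (q, x+1).  Then x cannot close
  -- its block via T, and an arc (x,j) with j > x+1 would cross (q, x+1): the
  -- non-crossing condition would force x + 1 = −x.
  ¬opens⇒end : ∀ {x} → x ∈ X → x + 1ℤ ∈ X → ¬ MinInBlock n Λ (x + 1ℤ) → ChainEnd x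
  ¬opens⇒end {x} x∈ y∈ ¬y-min with min-or-arc y∈
  ... | inj₁ y-min = ⊥-elim (¬y-min y-min)
  ... | inj₂ (q , arc-qy@(_ , _ , q<y , _)) = from end⇔no-arcPlus no-arcPlus
    where
    no-arcPlus : ∀ j → ¬ ArcPlus n Λ x j
    no-arcPlus j (inj₂ (refl , _ , _ , _ , y-min)) = ¬y-min y-min
    no-arcPlus j (inj₁ (arc-xj@(_ , _ , x<j , _) , j≢y)) =
      succ≢neg x (proj₂ (proj₂ nc q x (x + 1ℤ) j arc-qy arc-xj q<x (i<i+1 x) y<j))
      where
      y<j : x + 1ℤ < j
      y<j = ZP.≤∧≢⇒< (i<j⇒i+1≤j x<j) (j≢y ∘ sym)
      q<x : q < x
      q<x = below-succ q<y λ { refl → j≢y (sym (arc-functional arc-qy arc-xj)) }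

  consecutive : ∀ {x y} → x ∈ X → y ∈ X → y ≡ x + 1ℤ → 𝟙 (end? x) N.+ 𝟙 (min? y) ≡ 1
  consecutive {x} x∈ y∈ refl = 𝟙-exactly-one (opens⇒¬end x∈ y∈) (¬opens⇒end x∈ y∈) (end? x) (min? (x + 1ℤ))

  -- Boundary terms.  Since 0 ∉ [±n], −1 ends its chain iff it is maximal in its block.
  -1-end⇔max : ChainEnd -[1+ 0 ] ⇔ MaxInBlock n Λ -[1+ 0 ]
  -1-end⇔max = mk⇔ end⇒max max⇒end
    where
    end⇒max : ChainEnd -[1+ 0 ] → MaxInBlock n Λ -[1+ 0 ]
    end⇒max at-end with max-or-arc -1∈X
    ... | inj₁ max = max
    ... | inj₂ (j , arc@(_ , j∈ , _)) =
      ⊥-elim (to end⇔no-arcPlus at-end j (inj₁ (arc , λ { refl → 0∉pm {n} j∈ })))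
    max⇒end : MaxInBlock n Λ -[1+ 0 ] → ChainEnd -[1+ 0 ]
    max⇒end max = from end⇔no-arcPlus λ
      { j (inj₁ (arc , _)) → arc⇒¬max arc max
      ; j (inj₂ (refl , _ , j∈ , _)) → 0∉pm {n} j∈ }

  top-end : ChainEnd (+ n)
  top-end = from end⇔no-arcPlus λ j ap → ZP.<⇒≱ (arcPlus-increasing ap) (pm-≤ (arcPlus-target ap))

  bottom-min : MinInBlock n Λ -[1+ m ]
  bottom-min x x∈ _ = pm-≥ x∈

  -- By the symmetry −Λ = Λ, 1 opens its block iff −1 closes its block.
  1-min⇔-1-max : MinInBlock n Λ (+ 1) ⇔ MaxInBlock n Λ -[1+ 0 ]
  1-min⇔-1-max = mk⇔ min⇒max max⇒min
    where
    mirror : ∀ {i j} → i ∈ X → j ∈ X → Same Λ i j → Same Λ (- i) (- j)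
    mirror i∈ j∈ = to (proj₁ (proj₁ nc) _ _ i∈ j∈)
    min⇒max : MinInBlock n Λ (+ 1) → MaxInBlock n Λ -[1+ 0 ]
    min⇒max min j j∈ same = ZP.neg-cancel-≤ (min (- j) (pm-neg {n} j∈) (mirror -1∈X j∈ same))
    max⇒min : MaxInBlock n Λ -[1+ 0 ] → MinInBlock n Λ (+ 1)
    max⇒min max j j∈ same = ZP.neg-cancel-≤ (max (- j) (pm-neg {n} j∈) (mirror (pm-neg {n} -1∈X) j∈ same))

  E : ℕ
  E = 𝟙 (minusOneMax? n Λ)

  -1-term : 𝟙 (end? -[1+ 0 ]) ≡ E
  -1-term = 𝟙-cong (⇔-trans -1-end⇔max (mk⇔ (-1∈X ,_) proj₂)) (end? -[1+ 0 ]) (minusOneMax? n Λ)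

  1-term : 𝟙 (min? (+ 1)) ≡ E
  1-term = 𝟙-cong (⇔-trans 1-min⇔-1-max (mk⇔ (-1∈X ,_) proj₂)) (min? (+ 1)) (minusOneMax? n Λ)

  ends+opens : ℤ → ℕ
  ends+opens x = 𝟙 (end? x) N.+ 𝟙 (min? x)

  -- The run −1, −2, …, −n telescopes (there, −(k+2) + 1 = −(k+1)).
  negative-run : sum (map (λ k → ends+opens -[1+ k ]) (upTo n)) ≡ 𝟙 (end? -[1+ 0 ]) N.+ m N.+ 𝟙 (min? -[1+ m ])
  negative-run = begin
    sum (map (λ k → ends+opens -[1+ k ]) (upTo n))
      ≡⟨ cong sum (LP.map-cong (λ k → NP.+-comm (𝟙 (end? -[1+ k ])) (𝟙 (min? -[1+ k ]))) (upTo n)) ⟩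
    sum (map (λ k → 𝟙 (min? -[1+ k ]) N.+ 𝟙 (end? -[1+ k ])) (upTo n))
      ≡⟨ telescope (λ k → 𝟙 (min? -[1+ k ])) (λ k → 𝟙 (end? -[1+ k ])) m adjacent ⟩
    𝟙 (end? -[1+ 0 ]) N.+ m N.+ 𝟙 (min? -[1+ m ]) ∎
    where
    open ≡-Reasoning
    adjacent : ∀ k → k N.< m → 𝟙 (min? -[1+ k ]) N.+ 𝟙 (end? -[1+ suc k ]) ≡ 1
    adjacent k k<m = trans (NP.+-comm (𝟙 (min? -[1+ k ])) (𝟙 (end? -[1+ suc k ])))
      (consecutive (pm⁺ (neg (suc k) (N.s≤s k<m))) (pm⁺ (neg k (NP.m≤n⇒m≤1+n k<m))) refl)

  positive-run : sum (map (λ k → ends+opens (+ suc k)) (upTo n)) ≡ 𝟙 (min? (+ 1)) N.+ m N.+ 𝟙 (end? (+ n))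
  positive-run = telescope (λ k → 𝟙 (end? (+ suc k))) (λ k → 𝟙 (min? (+ suc k))) m adjacent
    where
    adjacent : ∀ k → k N.< m → 𝟙 (end? (+ suc k)) N.+ 𝟙 (min? (+ suc (suc k))) ≡ 1
    adjacent k k<m = consecutive (pm⁺ (pos k (NP.m≤n⇒m≤1+n k<m))) (pm⁺ (pos (suc k) (N.s≤s k<m)))
      (cong +_ (NP.+-comm 1 (suc k)))

  block-count : blocks n Λ⁺ N.+ blocks n Λ ≡ 2 * n N.+ 2 * E
  block-count = begin
    blocks n Λ⁺ N.+ blocks n Λ
      ≡⟨ cong₂ N._+_ blocks⁺-by-ends blocks-by-minima ⟩
    sum (map (λ x → 𝟙 (end? x)) X) N.+ sum (map (λ x → 𝟙 (min? x)) X)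
      ≡⟨ sum-map-+ (λ x → 𝟙 (end? x)) (λ x → 𝟙 (min? x)) X ⟨
    sum (map ends+opens X)
      ≡⟨ sum-pm ends+opens n ⟩
    sum (map (λ k → ends+opens -[1+ k ]) (upTo n)) N.+ sum (map (λ k → ends+opens (+ suc k)) (upTo n))
      ≡⟨ cong₂ N._+_ negative-run positive-run ⟩
    (𝟙 (end? -[1+ 0 ]) N.+ m N.+ 𝟙 (min? -[1+ m ])) N.+ (𝟙 (min? (+ 1)) N.+ m N.+ 𝟙 (end? (+ n)))
      ≡⟨ cong₂ N._+_ (cong₂ (λ a b → a N.+ m N.+ b) -1-term (𝟙-yes bottom-min (min? -[1+ m ])))
                     (cong₂ (λ a b → a N.+ m N.+ b) 1-term (𝟙-yes top-end (end? (+ n)))) ⟩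
    (E N.+ m N.+ 1) N.+ (E N.+ m N.+ 1)
      ≡⟨ double E m ⟩
    2 * n N.+ 2 * E ∎
    where
    open ≡-Reasoning
    double : ∀ e m → (e N.+ m N.+ 1) N.+ (e N.+ m N.+ 1) ≡ 2 * suc m N.+ 2 * e
    double = solve-∀

blocks-sum : ∀ n Λ → InNCD n Λ → blocks n (Plus.Λ⁺ n Λ) N.+ blocks n Λ ≡ 2 * n N.+ 2 * 𝟙 (minusOneMax? n Λ)
blocks-sum zero Λ _ = refl
blocks-sum (suc m) Λ nc = Counting.block-count m Λ nc

subtract : ∀ {a b c} → a N.+ b ≡ c → a ≡ c ∸ b
subtract {a} {b} refl = sym (NP.m+n∸n≡m a b)

corollary5p2 : (n : ℕ) (Λ : Labelling) → InNCD n Λ →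
    Σ Labelling (λ Λ⁺ →
    (∀ i j → i ∈ pm n → j ∈ pm n → Arc n Λ⁺ i j ⇔ ArcPlus n Λ i j)
    × (MinusOneMax n Λ → blocks n Λ⁺ ≡ (2 * n N.+ 2) ∸ blocks n Λ)
    × (¬ MinusOneMax n Λ → blocks n Λ⁺ ≡ 2 * n ∸ blocks n Λ))
corollary5p2 n Λ nc = Λ⁺ , (λ i j i∈ _ → arcs⁺ i∈) , when-max , when-not-max
  where
  open Plus n Λ using (Λ⁺; arcs⁺)
  when-max : MinusOneMax n Λ → blocks n Λ⁺ ≡ (2 * n N.+ 2) ∸ blocks n Λ
  when-max max = subtract (trans (blocks-sum n Λ nc) (cong (λ e → 2 * n N.+ 2 * e) (𝟙-yes max (minusOneMax? n Λ))))
  when-not-max : ¬ MinusOneMax n Λ → blocks n Λ⁺ ≡ 2 * n ∸ blocks n Λ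
  when-not-max ¬max = subtract (begin
    blocks n Λ⁺ N.+ blocks n Λ           ≡⟨ blocks-sum n Λ nc ⟩
    2 * n N.+ 2 * 𝟙 (minusOneMax? n Λ)  ≡⟨ cong (λ e → 2 * n N.+ 2 * e) (𝟙-no ¬max (minusOneMax? n Λ)) ⟩
    2 * n N.+ 0                          ≡⟨ NP.+-identityʳ (2 * n) ⟩
    2 * n                                ∎)
    where open ≡-Reasoning
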